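{- Let $n \geq 1$. The function $[n] \to (C_n \cong C_n)$ sending $k$ to $\mathsf{rot}^k$ is a bijection. Moreover, if $k_1, k_2 < n$ and $\mathsf{rot}^{k_1} = \mathsf{rot}^{k_2}$, then $k_1 = k_2$.
   Context: Work in homotopy type theory with a univalent universe $\mathcal{U}$. A graph $G$ consists of a set of nodes $N_G$ and a set-valued edge family $E_G : N_G\to N_G\to\mathcal{U}$; a homomorphism $(\alpha,\beta) : G\to H$ consists of $\alpha:N_G\to N_H$ and $\beta:\prod_{x,y}E_G(x,y)\to E_H(\alpha x,\alpha y)$; $G\cong H$ is the type of homomorphisms with an inverse homomorphism (equivalently, $\alpha$ and all $\beta(x,y)$ bijections). $[n]$ is the standard finite set $\{0,\dots,n-1\}$ and $\mathsf{pred}:[n]\to[n]$ sends $0\mapsto n-1$, $i+1\mapsto i$. For $n\ge1$ the cycle graph $C_n$ has nodes $[n]$ and edges $E_{C_n}(u,v) :\equiv (u = \mathsf{pred}(v))$. $\mathsf{rot} : C_n \cong C_n$ is the automorphism acting on nodes by $\mathsf{pred}$ (and on edges by applying $\mathsf{pred}$ to the equation $u=\mathsf{pred}(v)$); $\mathsf{rot}^k$ is its $k$-fold composite. -}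

module Defs where

open import Data.Nat using (ℕ; zero; suc)
open import Data.Fin using (Fin; zero; suc; fromℕ; inject₁)
open import Data.Fin.Properties using (_≟_)
open import Data.Product using (Σ; _,_)
open import Relation.Binary.PropositionalEquality
  using (_≡_; refl; sym; trans; cong; subst₂)
open import Axiom.UniquenessOfIdentityProofs using (module Decidable⇒UIP)

record Graph : Set₁ where
  field
    Node : Set
    Edge : Node → Node → Set
open Graph public

record Hom (G H : Graph) : Set where
  field
    α : Node G → Node H
    β : ∀ {x y} → Edge G x y → Edge H (α x) (α y)
open Hom public

record Iso (G H : Graph) : Set where
  field
    to   : Hom G H
    from : Hom H G
    linv-α : ∀ x → α from (α to x) ≡ x
    rinv-α : ∀ y → α to (α from y) ≡ y
    linv-β : ∀ {x y} (e : Edge G x y) →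
      subst₂ (Edge G) (linv-α x) (linv-α y) (β from (β to e)) ≡ e
    rinv-β : ∀ {x y} (e : Edge H x y) →
      subst₂ (Edge H) (rinv-α x) (rinv-α y) (β to (β from e)) ≡ e
open Iso public

-- Equality of isomorphisms (extensional: the forward homomorphism agrees on
-- nodes, and on edges up to transport along the node equalities; the inverse
-- data is uniquely determined by the forward map).
record _≈ᵢ_ {G H : Graph} (φ ψ : Iso G H) : Set where
  field
    α≈ : ∀ x → α (to φ) x ≡ α (to ψ) x
    β≈ : ∀ {x y} (e : Edge G x y) →
      subst₂ (Edge H) (α≈ x) (α≈ y) (β (to φ) e) ≡ β (to ψ) e

pred : ∀ {m} → Fin (suc m) → Fin (suc m)
pred {m} zero = fromℕ m
pred (suc i) = inject₁ i

-- its inverse, successor mod n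
succ : ∀ {m} → Fin (suc m) → Fin (suc m)
succ {zero} zero = zero
succ {suc m} zero = suc zero
succ {suc m} (suc i) with succ {m} i
... | zero = zero
... | suc j = suc (suc j)

-- Cycle graph C_n for n = suc m (i.e. n ≥ 1): E(u,v) = (u ≡ pred v)
C : ℕ → Graph
C m = record { Node = Fin (suc m) ; Edge = λ u v → u ≡ pred v }

private
  succ-inject : ∀ {m} (i : Fin (suc m)) → succ {suc m} (inject₁ i) ≡ suc i
  succ-inject {zero} zero = refl
  succ-inject {suc m} zero = refl
  succ-inject {suc m} (suc i) with succ {suc m} (inject₁ i) | succ-inject i
  ... | suc .(i) | refl = refl

  succ-fromℕ : ∀ m → succ {m} (fromℕ m) ≡ zero
  succ-fromℕ zero = refl
  succ-fromℕ (suc m) rewrite succ-fromℕ m = refl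

  succ-pred : ∀ {m} (i : Fin (suc m)) → succ (pred i) ≡ i
  succ-pred {m} zero = succ-fromℕ m
  succ-pred {suc m} (suc i) = succ-inject {m} i

  pred-succ : ∀ {m} (i : Fin (suc m)) → pred (succ i) ≡ i
  pred-succ {zero} zero = refl
  pred-succ {suc m} zero = refl
  pred-succ {suc m} (suc i) with succ {m} i | pred-succ {m} i
  ... | zero | eq = cong suc eq
  ... | suc j | eq = cong suc eq

private
  uipFin : ∀ {m} {a b : Fin m} (p q : a ≡ b) → p ≡ q
  uipFin {m} = Decidable⇒UIP.≡-irrelevant (_≟_ {m})

  edgeProp : ∀ {m} (u v : Fin (suc m)) (p q : Edge (C m) u v) → p ≡ q
  edgeProp u v = uipFin

idHom : (G : Graph) → Hom G G
idHom G = record { α = λ x → x ; β = λ e → e }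

_∘H_ : ∀ {G H K : Graph} → Hom H K → Hom G H → Hom G K
g ∘H f = record { α = λ x → α g (α f x) ; β = λ e → β g (β f e) }

idC : ∀ m → Iso (C m) (C m)
idC m = record
  { to = idHom (C m) ; from = idHom (C m)
  ; linv-α = λ _ → refl ; rinv-α = λ _ → refl
  ; linv-β = λ _ → refl ; rinv-β = λ _ → refl }

_∘C_ : ∀ {m} → Iso (C m) (C m) → Iso (C m) (C m) → Iso (C m) (C m)
_∘C_ {m} ψ φ = record
  { to = to ψ ∘H to φ
  ; from = from φ ∘H from ψ
  ; linv-α = λ x → trans (cong (α (from φ)) (linv-α ψ (α (to φ) x))) (linv-α φ x)
  ; rinv-α = λ y → trans (cong (α (to ψ)) (rinv-α φ (α (from ψ) y))) (rinv-α ψ y)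
  ; linv-β = λ {x} {y} _ → edgeProp x y _ _
  ; rinv-β = λ {x} {y} _ → edgeProp x y _ _ }

rot : ∀ m → Iso (C m) (C m)
rot m = record
  { to = record { α = pred ; β = λ e → cong pred e }
  ; from = record { α = succ ; β = λ {x} {y} e →
      trans (cong succ e) (trans (succ-pred y) (sym (pred-succ y))) }
  ; linv-α = succ-pred ; rinv-α = pred-succ
  ; linv-β = λ {x} {y} _ → edgeProp x y _ _
  ; rinv-β = λ {x} {y} _ → edgeProp x y _ _ }

rot^ : ∀ m → ℕ → Iso (C m) (C m)
rot^ m zero = idC m
rot^ m (suc k) = rot m ∘C rot^ m k

-- Every automorphism of C_n commutes with pred, and every node is pred^j of the
-- top node n-1, so an automorphism is determined by the image of the top node.
-- Since rot^k sends the top node to the node with index n-1-k, the powers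
-- rot^0, …, rot^(n-1) realise every image exactly once.
module Submission where

open import Defs
open import Data.Nat using (ℕ; suc; _<_)
open import Data.Fin using (Fin; toℕ)
open import Data.Product using (Σ; _×_)
open import Relation.Binary.PropositionalEquality using (_≡_)

open import Data.Nat as ℕ using (zero; _∸_; _≤_)
open import Data.Nat.Properties
  using (≤-pred; <⇒≤; m<n⇒0<n∸m; pred[m∸n]≡m∸[1+n]; ∸-cancelˡ-≡; m∸[m∸n]≡n)
open import Data.Fin using (suc; fromℕ; opposite)
open import Data.Fin.Properties
  using (_≟_; toℕ-injective; toℕ-fromℕ; toℕ-inject₁; toℕ≤pred[n]; opposite-prop)
open import Data.Product using (_,_)
open import Function using (_∘′_)
open import Relation.Binary.PropositionalEquality using (refl; sym; trans; cong; module ≡-Reasoning)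
open import Axiom.UniquenessOfIdentityProofs using (module Decidable⇒UIP)

pred^ : ∀ {m} → ℕ → Fin (suc m) → Fin (suc m)
pred^ zero    x = x
pred^ (suc k) x = pred (pred^ k x)

toℕ-pred : ∀ {m} (x : Fin (suc m)) → 0 < toℕ x → toℕ (pred x) ≡ ℕ.pred (toℕ x)
toℕ-pred (suc i) _ = toℕ-inject₁ i

toℕ-pred^-fromℕ : ∀ {m k} → k ≤ m → toℕ (pred^ k (fromℕ m)) ≡ m ∸ k
toℕ-pred^-fromℕ {m} {zero}  _   = toℕ-fromℕ m
toℕ-pred^-fromℕ {m} {suc k} k<m = begin
  toℕ (pred (pred^ k (fromℕ m)))     ≡⟨ toℕ-pred _ 0<toℕ ⟩
  ℕ.pred (toℕ (pred^ k (fromℕ m)))   ≡⟨ cong ℕ.pred toℕ-pred^k ⟩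
  ℕ.pred (m ∸ k)                     ≡⟨ pred[m∸n]≡m∸[1+n] m k ⟩
  m ∸ suc k                          ∎
  where
  open ≡-Reasoning
  toℕ-pred^k : toℕ (pred^ k (fromℕ m)) ≡ m ∸ k
  toℕ-pred^k = toℕ-pred^-fromℕ (<⇒≤ k<m)
  0<toℕ : 0 < toℕ (pred^ k (fromℕ m))
  0<toℕ rewrite toℕ-pred^k = m<n⇒0<n∸m k<m

pred^-opposite-fromℕ : ∀ {m} (y : Fin (suc m)) → pred^ (toℕ (opposite y)) (fromℕ m) ≡ y
pred^-opposite-fromℕ {m} y = toℕ-injective (begin
  toℕ (pred^ (toℕ (opposite y)) (fromℕ m)) ≡⟨ toℕ-pred^-fromℕ (toℕ≤pred[n] (opposite y)) ⟩
  m ∸ toℕ (opposite y)                      ≡⟨ cong (m ∸_) (opposite-prop y) ⟩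
  m ∸ (m ∸ toℕ y)                           ≡⟨ m∸[m∸n]≡n (toℕ≤pred[n] y) ⟩
  toℕ y                                     ∎)
  where open ≡-Reasoning

α-rot^ : ∀ m k (x : Fin (suc m)) → α (to (rot^ m k)) x ≡ pred^ k x
α-rot^ m zero    x = refl
α-rot^ m (suc k) x = cong pred (α-rot^ m k x)

α-pred : ∀ {m n} (f : Hom (C m) (C n)) (x : Fin (suc m)) → α f (pred x) ≡ pred (α f x)
α-pred f x = β f {pred x} {x} refl

α-pred^ : ∀ {m n} (f : Hom (C m) (C n)) j (x : Fin (suc m)) →
  α f (pred^ j x) ≡ pred^ j (α f x)
α-pred^ f zero    x = refl
α-pred^ f (suc j) x = trans (α-pred f (pred^ j x)) (cong pred (α-pred^ f j x))

α-determined-by-fromℕ : ∀ {m n} (f g : Hom (C m) (C n)) →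
  α f (fromℕ m) ≡ α g (fromℕ m) → ∀ x → α f x ≡ α g x
α-determined-by-fromℕ {m} f g f≡g x = begin
  α f x                   ≡⟨ cong (α f) (sym (pred^-opposite-fromℕ x)) ⟩
  α f (pred^ j (fromℕ m)) ≡⟨ α-pred^ f j (fromℕ m) ⟩
  pred^ j (α f (fromℕ m)) ≡⟨ cong (pred^ j) f≡g ⟩
  pred^ j (α g (fromℕ m)) ≡⟨ sym (α-pred^ g j (fromℕ m)) ⟩
  α g (pred^ j (fromℕ m)) ≡⟨ cong (α g) (pred^-opposite-fromℕ x) ⟩
  α g x                   ∎
  where
  open ≡-Reasoning
  j : ℕ
  j = toℕ (opposite x)

-- Edges of C_n are equations between elements of Fin, which have unique proofs.
≈ᵢ-fromα : ∀ {G n} {φ ψ : Iso G (C n)} → (∀ x → α (to φ) x ≡ α (to ψ) x) → φ ≈ᵢ ψ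
≈ᵢ-fromα α≈ = record { α≈ = α≈ ; β≈ = λ _ → Decidable⇒UIP.≡-irrelevant _≟_ _ _ }

rot^-injective : ∀ m {k₁ k₂} → k₁ ≤ m → k₂ ≤ m → rot^ m k₁ ≈ᵢ rot^ m k₂ → k₁ ≡ k₂
rot^-injective m {k₁} {k₂} k₁≤m k₂≤m rot^k₁≈rot^k₂ = ∸-cancelˡ-≡ k₁≤m k₂≤m (begin
  m ∸ k₁                             ≡⟨ sym (toℕ-pred^-fromℕ k₁≤m) ⟩
  toℕ (pred^ k₁ (fromℕ m))           ≡⟨ cong toℕ (sym (α-rot^ m k₁ (fromℕ m))) ⟩
  toℕ (α (to (rot^ m k₁)) (fromℕ m)) ≡⟨ cong toℕ (_≈ᵢ_.α≈ rot^k₁≈rot^k₂ (fromℕ m)) ⟩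
  toℕ (α (to (rot^ m k₂)) (fromℕ m)) ≡⟨ cong toℕ (α-rot^ m k₂ (fromℕ m)) ⟩
  toℕ (pred^ k₂ (fromℕ m))           ≡⟨ toℕ-pred^-fromℕ k₂≤m ⟩
  m ∸ k₂                             ∎)
  where open ≡-Reasoning

rot^-surjective : ∀ m (φ : Iso (C m) (C m)) → Σ (Fin (suc m)) (λ k → rot^ m (toℕ k) ≈ᵢ φ)
rot^-surjective m φ = k , ≈ᵢ-fromα (α-determined-by-fromℕ (to (rot^ m (toℕ k))) (to φ)
  (trans (α-rot^ m (toℕ k) (fromℕ m)) (pred^-opposite-fromℕ (α (to φ) (fromℕ m)))))
  where
  k : Fin (suc m)
  k = opposite (α (to φ) (fromℕ m))

lemma3p20 : (m : ℕ) →
    ((k₁ k₂ : Fin (suc m)) → rot^ m (toℕ k₁) ≈ᵢ rot^ m (toℕ k₂) → k₁ ≡ k₂)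
    × ((φ : Iso (C m) (C m)) → Σ (Fin (suc m)) (λ k → rot^ m (toℕ k) ≈ᵢ φ))
    × ((k₁ k₂ : ℕ) → k₁ < suc m → k₂ < suc m → rot^ m k₁ ≈ᵢ rot^ m k₂ → k₁ ≡ k₂)
lemma3p20 m =
    (λ k₁ k₂ → toℕ-injective ∘′ rot^-injective m (toℕ≤pred[n] k₁) (toℕ≤pred[n] k₂))
  , rot^-surjective m
  , (λ k₁ k₂ k₁<n k₂<n → rot^-injective m (≤-pred k₁<n) (≤-pred k₂<n))
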